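{- Let $S$ be an S-tree. Then for every maximum matching $M$ of $S$ and every edge $e\in M$, $|e\cap\operatorname{Core}(S)|=1$.
   Context: For a tree $S$, $\mathcal{N}(S)$ is the null space of its adjacency matrix and $\operatorname{Supp}(S)=\{v\in V(S): x_v\neq0\text{ for some }x\in\mathcal{N}(S)\}$. $S$ is an S-tree if $N[\operatorname{Supp}(S)]=V(S)$, where $N[X]=\bigcup_{u\in X}(N(u)\cup\{u\})$. $\operatorname{Core}(S)=N(\operatorname{Supp}(S))=\bigcup_{u\in\operatorname{Supp}(S)}N(u)$. -}

module Defs where

open import Data.Nat using (ℕ; zero; suc; _≤_; _≥_)
open import Data.Fin using (Fin)
open import Data.Bool using (Bool; true; false; if_then_else_)
open import Data.Rational using (ℚ; 0ℚ; 1ℚ; _+_; _*_)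
open import Data.List using (List; []; _∷_; length; concatMap)
open import Data.List.Membership.Propositional using (_∈_)
open import Data.List.Relation.Unary.All using (All)
open import Data.List.Relation.Unary.Unique.Propositional using (Unique)
open import Data.Product using (Σ; ∃; _×_; _,_)
open import Data.Sum using (_⊎_)
open import Relation.Binary.PropositionalEquality using (_≡_; _≢_)
open import Relation.Nullary using (¬_)

Adj : ℕ → Set
Adj n = Fin n → Fin n → Bool

_~[_]_ : {n : ℕ} → Fin n → Adj n → Fin n → Set
u ~[ A ] v = A u v ≡ true

data Walk {n : ℕ} (A : Adj n) : Fin n → Fin n → List (Fin n) → Set where
  here : (v : Fin n) → Walk A v v (v ∷ [])
  step : {u w v : Fin n} {vs : List (Fin n)} →
         u ~[ A ] w → Walk A w v vs → Walk A u v (u ∷ vs)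

HasCycle : {n : ℕ} → Adj n → Set
HasCycle {n} A = Σ (Fin n) λ u → Σ (Fin n) λ v → Σ (List (Fin n)) λ vs →
  Walk A u v vs × Unique vs × length vs ≥ 3 × v ~[ A ] u

record IsTree {n : ℕ} (A : Adj n) : Set where
  field
    nonempty   : n ≥ 1
    symmetric  : ∀ u v → A u v ≡ A v u
    irreflexive : ∀ v → A v v ≡ false
    connected  : ∀ u v → Σ (List (Fin n)) λ vs → Walk A u v vs
    acyclic    : ¬ HasCycle A

sumℚ : (n : ℕ) → (Fin n → ℚ) → ℚ
sumℚ zero    f = 0ℚ
sumℚ (suc n) f = f Fin.zero + sumℚ n (λ i → f (Fin.suc i))

adjMat : {n : ℕ} → Adj n → Fin n → Fin n → ℚ
adjMat A i j = if A i j then 1ℚ else 0ℚ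

InNullSpace : {n : ℕ} → Adj n → (Fin n → ℚ) → Set
InNullSpace {n} A x = ∀ i → sumℚ n (λ j → adjMat A i j * x j) ≡ 0ℚ

Supp : {n : ℕ} → Adj n → Fin n → Set
Supp {n} A v = Σ (Fin n → ℚ) λ x → InNullSpace A x × x v ≢ 0ℚ

IsSTree : {n : ℕ} → Adj n → Set
IsSTree {n} A = IsTree A × (∀ v → Σ (Fin n) λ u → Supp A u × (u ≡ v ⊎ u ~[ A ] v))

Core : {n : ℕ} → Adj n → Fin n → Set
Core {n} A v = Σ (Fin n) λ u → Supp A u × u ~[ A ] v

endpoints : {n : ℕ} → List (Fin n × Fin n) → List (Fin n)
endpoints = concatMap (λ { (u , v) → u ∷ v ∷ [] })

IsMatching : {n : ℕ} → Adj n → List (Fin n × Fin n) → Set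
IsMatching A M = All (λ { (u , v) → u ~[ A ] v }) M × Unique (endpoints M)

IsMaximumMatching : {n : ℕ} → Adj n → List (Fin n × Fin n) → Set
IsMaximumMatching {n} A M =
  IsMatching A M × (∀ (M' : List (Fin n × Fin n)) → IsMatching A M' → length M' ≤ length M)

-- |{u , v} ∩ X| = 1  (for u ≠ v)
ExactlyOneIn : {n : ℕ} → (Fin n → Set) → Fin n × Fin n → Set
ExactlyOneIn X (u , v) = (X u × ¬ X v) ⊎ (¬ X u × X v)

module Submission where

-- At least one end lies in Core, because u is a support vertex (then v ∈ Core) or is
-- adjacent to one (then u ∈ Core).  For "at most one" the key fact is support
-- propagation: if x is a null vector, x w ≠ 0 and p ~ w, then p has a second
-- neighbour j with x j ≠ 0.  Starting from a support vertex h and repeatedly following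
-- the matching edge at the current vertex and then such a j, one walks along a path of
-- the tree (acyclicity forbids returning) that must end at an unmatched vertex;
-- shifting the matching along it frees h without changing anything off the path
-- (releaseSupport).  If both u and v were in Core, freeing a support neighbour d of v
-- and then one c of u would leave c–u–v–d as an augmenting path, contradicting
-- maximality (notBothCore).

open import Defs
open import Data.Nat using (ℕ; zero; suc; _≤_; _+_; s≤s; z≤n)
open import Data.Nat.Properties using (≤-trans; ≤-reflexive; n≤1+n; m≤m+n; +-suc; 1+n≰n)
open import Data.Fin using (Fin; zero; suc)
open import Data.Fin.Properties using (injective⇒≤; suc-injective)
  renaming (_≟_ to _≟ᶠ_; any? to anyᶠ?)
open import Data.Bool using (true; false; if_then_else_)
open import Data.Rational using (ℚ; 0ℚ; 1ℚ; _*_) renaming (_+_ to _+ℚ_)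
import Data.Rational.Properties as ℚ
open import Data.List using (List; []; _∷_; _++_; length; lookup)
open import Data.List.Membership.Propositional using (_∈_; _∉_)
open import Data.List.Membership.Propositional.Properties using (∈-lookup; ∈-∃++)
open import Data.List.Relation.Unary.Any using (here; there; any?)
open import Data.List.Relation.Unary.All using (All; []; _∷_)
import Data.List.Relation.Unary.All as All
open import Data.List.Relation.Unary.All.Properties using (¬Any⇒All¬; All¬⇒¬Any; anti-mono)
open import Data.List.Relation.Unary.AllPairs using ([]; _∷_)
open import Data.List.Relation.Unary.Unique.Propositional using (Unique)
open import Data.List.Relation.Unary.Unique.Propositional.Properties using (Unique[x∷xs]⇒x∉xs)
open import Data.List.Relation.Binary.Subset.Propositional using (_⊆_)
open import Data.List.Relation.Binary.Subset.Propositional.Properties using (∷⁺ʳ; ∈-∷⁺ʳ)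
import Data.List.Relation.Binary.Permutation.Propositional as Perm
open Perm using (_↭_; ↭-sym; ↭⇒↭ₛ)
open import Data.List.Relation.Binary.Permutation.Propositional.Properties
  using (↭-length; All-resp-↭; ∈-resp-↭; shift; shifts; ++⁺ˡ)
import Data.List.Relation.Binary.Permutation.Setoid.Properties as SetoidPerm
open import Data.Product using (Σ; _×_; _,_; proj₁)
open import Data.Sum using (_⊎_; inj₁; inj₂)
open import Data.Empty using (⊥; ⊥-elim)
open import Relation.Nullary using (¬_; yes; no)
open import Relation.Nullary.Decidable using (¬?; _×-dec_; decidable-stable)
open import Relation.Binary.PropositionalEquality
  using (_≡_; _≢_; ≢-sym; refl; sym; trans; cong; cong₂; subst; setoid; module ≡-Reasoning)

lookup-injective : ∀ {X : Set} {xs : List X} → Unique xs →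
  ∀ {i j} → lookup xs i ≡ lookup xs j → i ≡ j
lookup-injective (_ ∷ _)  {zero}  {zero}  _  = refl
lookup-injective (x∉ ∷ u) {zero}  {suc j} eq = ⊥-elim (All.lookup x∉ (∈-lookup j) eq)
lookup-injective (x∉ ∷ u) {suc i} {zero}  eq = ⊥-elim (All.lookup x∉ (∈-lookup i) (sym eq))
lookup-injective (_  ∷ u) {suc i} {suc j} eq = cong suc (lookup-injective u eq)

unique-length≤ : ∀ {n} {xs : List (Fin n)} → Unique xs → length xs ≤ n
unique-length≤ u = injective⇒≤ (lookup-injective u)

unique-↭ : ∀ {X : Set} {xs ys : List X} → xs ↭ ys → Unique xs → Unique ys
unique-↭ {X} p = Unique-resp-↭ (↭⇒↭ₛ p)
  where open SetoidPerm (setoid X) using (Unique-resp-↭)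

∉-∷ : ∀ {X : Set} {x y : X} {ys : List X} → x ≢ y → x ∉ ys → x ∉ y ∷ ys
∉-∷ x≢y x∉ (here x≡y) = x≢y x≡y
∉-∷ x≢y x∉ (there x∈) = x∉ x∈

head⊆ : ∀ {X : Set} {x : X} {xs : List X} → x ∷ [] ⊆ x ∷ xs
head⊆ = ∈-∷⁺ʳ (here refl) λ ()

∉-singleton : ∀ {X : Set} {x y : X} → x ≢ y → x ∉ y ∷ []
∉-singleton x≢y = ∉-∷ x≢y λ ()

∈-∉⇒≢ : ∀ {X : Set} {x y : X} {ys : List X} → x ∈ ys → y ∉ ys → x ≢ y
∈-∉⇒≢ x∈ y∉ refl = y∉ x∈

sumℚ-zero : ∀ n (f : Fin n → ℚ) → (∀ j → f j ≡ 0ℚ) → sumℚ n f ≡ 0ℚ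
sumℚ-zero zero    f vanish = refl
sumℚ-zero (suc n) f vanish =
  trans (cong₂ _+ℚ_ (vanish zero) (sumℚ-zero n (λ j → f (suc j)) (λ j → vanish (suc j))))
        (ℚ.+-identityʳ 0ℚ)

sumℚ-single : ∀ n (f : Fin n → ℚ) (w : Fin n) → (∀ j → j ≢ w → f j ≡ 0ℚ) → sumℚ n f ≡ f w
sumℚ-single (suc n) f zero vanish =
  trans (cong (f zero +ℚ_) (sumℚ-zero n (λ j → f (suc j)) (λ j → vanish (suc j) λ ())))
        (ℚ.+-identityʳ (f zero))
sumℚ-single (suc n) f (suc w) vanish =
  trans (cong₂ _+ℚ_ (vanish zero λ ())
                     (sumℚ-single n (λ j → f (suc j)) w
                        (λ j j≢w → vanish (suc j) (λ sj≡sw → j≢w (suc-injective sj≡sw)))))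
        (ℚ.+-identityˡ (f (suc w)))

entry≢0 : ∀ b q → (if b then 1ℚ else 0ℚ) * q ≢ 0ℚ → b ≡ true × q ≢ 0ℚ
entry≢0 true  q term≢0 = refl , λ q≡0 → term≢0 (trans (ℚ.*-identityˡ q) q≡0)
entry≢0 false q term≢0 = ⊥-elim (term≢0 (ℚ.*-zeroˡ q))

entry-edge : ∀ {b} q → b ≡ true → (if b then 1ℚ else 0ℚ) * q ≡ q
entry-edge q refl = ℚ.*-identityˡ q

-- Propagation of the support: if x is a null vector and p is adjacent to a vertex w
-- with x w ≠ 0, then p has another neighbour j ≠ w with x j ≠ 0, for otherwise the
-- p-th entry of A · x would be x w ≠ 0.
otherSupportNeighbour : ∀ {n} (A : Adj n) {x : Fin n → ℚ} → InNullSpace A x →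
  ∀ {p w} → p ~[ A ] w → x w ≢ 0ℚ → Σ (Fin n) λ j → j ≢ w × p ~[ A ] j × x j ≢ 0ℚ
otherSupportNeighbour {n} A {x} null {p} {w} p~w xw≢0
  with anyᶠ? (λ j → ¬? (j ≟ᶠ w) ×-dec ¬? (adjMat A p j * x j ℚ.≟ 0ℚ))
... | yes (j , j≢w , term≢0) = let (p~j , xj≢0) = entry≢0 (A p j) (x j) term≢0 in j , j≢w , p~j , xj≢0
... | no none = ⊥-elim (xw≢0 xw≡0)
  where
  vanish : ∀ j → j ≢ w → adjMat A p j * x j ≡ 0ℚ
  vanish j j≢w = decidable-stable (adjMat A p j * x j ℚ.≟ 0ℚ) (λ term≢0 → none (j , j≢w , term≢0))
  open ≡-Reasoning
  xw≡0 : x w ≡ 0ℚ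
  xw≡0 = begin
    x w                                   ≡⟨ sym (entry-edge (x w) p~w) ⟩
    adjMat A p w * x w                    ≡⟨ sym (sumℚ-single n (λ j → adjMat A p j * x j) w vanish) ⟩
    sumℚ n (λ j → adjMat A p j * x j)     ≡⟨ null p ⟩
    0ℚ                                    ∎

module SimpleGraph {n : ℕ} {A : Adj n}
  (symmetric : ∀ u v → A u v ≡ A v u) (irreflexive : ∀ v → A v v ≡ false) where

  V : Set
  V = Fin n

  E : Set
  E = V × V

  private variable
    a b c h j p w x y : V
    t : E
    M M′ : List E
    T T′ : List V

  ~-sym : a ~[ A ] b → b ~[ A ] a
  ~-sym {a} {b} a~b = trans (symmetric b a) a~b

  ~-≢ : a ~[ A ] b → a ≢ b
  ~-≢ {a} a~a refl with trans (sym a~a) (irreflexive a)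
  ... | ()

  -- A vertex u of Core A has, for every neighbour v, a support neighbour other than v:
  -- if its witnessing support neighbour is v itself, propagate the support from v.
  supportNeighbourAvoiding : ∀ {u v} → Core A u → u ~[ A ] v →
    Σ V λ c → Supp A c × c ~[ A ] u × c ≢ v
  supportNeighbourAvoiding {u} {v} (a , supp@(x , null , xa≢0) , a~u) u~v with a ≟ᶠ v
  ... | no a≢v = a , supp , a~u , a≢v
  ... | yes refl =
    let (c , c≢a , u~c , xc≢0) = otherSupportNeighbour A null u~v xa≢0
    in c , (x , null , xc≢0) , ~-sym u~c , c≢a

  Partner : List E → V → V → Set
  Partner M x y = (x , y) ∈ M ⊎ (y , x) ∈ M

  partner-sym : Partner M x y → Partner M y x
  partner-sym (inj₁ xy∈) = inj₂ xy∈
  partner-sym (inj₂ yx∈) = inj₁ yx∈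

  partner-there : Partner M x y → Partner (t ∷ M) x y
  partner-there (inj₁ xy∈) = inj₁ (there xy∈)
  partner-there (inj₂ yx∈) = inj₂ (there yx∈)

  partner-~ : IsMatching A M → Partner M x y → x ~[ A ] y
  partner-~ (adjacent , _) (inj₁ xy∈) = All.lookup adjacent xy∈
  partner-~ (adjacent , _) (inj₂ yx∈) = ~-sym (All.lookup adjacent yx∈)

  partner-endpoint : Partner M x y → x ∈ endpoints M
  partner-endpoint {M = (a , b) ∷ M} (inj₁ (here refl)) = here refl
  partner-endpoint {M = (a , b) ∷ M} (inj₂ (here refl)) = there (here refl)
  partner-endpoint {M = (a , b) ∷ M} (inj₁ (there xy∈)) = there (there (partner-endpoint (inj₁ xy∈)))
  partner-endpoint {M = (a , b) ∷ M} (inj₂ (there yx∈)) = there (there (partner-endpoint (inj₂ yx∈)))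

  endpoint-partner : w ∈ endpoints M → Σ V (Partner M w)
  endpoint-partner {M = (a , b) ∷ M} (here refl)         = b , inj₁ (here refl)
  endpoint-partner {M = (a , b) ∷ M} (there (here refl)) = a , inj₂ (here refl)
  endpoint-partner {M = (a , b) ∷ M} (there (there w∈))  =
    let (p , w-p) = endpoint-partner w∈ in p , partner-there w-p

  partner? : ∀ M w → w ∉ endpoints M ⊎ Σ V (Partner M w)
  partner? M w with any? (w ≟ᶠ_) (endpoints M)
  ... | yes w∈ = inj₂ (endpoint-partner w∈)
  ... | no w∉  = inj₁ w∉

  data Partner∷ (a b : V) (M : List E) : V → V → Set where
    forward  : Partner∷ a b M a b
    backward : Partner∷ a b M b a
    later    : Partner M x y → Partner∷ a b M x y

  partner∷ : Partner ((a , b) ∷ M) x y → Partner∷ a b M x y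
  partner∷ (inj₁ (here refl))  = forward
  partner∷ (inj₂ (here refl))  = backward
  partner∷ (inj₁ (there xy∈)) = later (inj₁ xy∈)
  partner∷ (inj₂ (there yx∈)) = later (inj₂ yx∈)

  partner∷⁻ : Partner ((a , b) ∷ M) x y → x ≢ a → x ≢ b → Partner M x y
  partner∷⁻ xy with partner∷ xy
  ... | forward  = λ x≢a _ → ⊥-elim (x≢a refl)
  ... | backward = λ _ x≢b → ⊥-elim (x≢b refl)
  ... | later xy′ = λ _ _ → xy′

  ∷-matching : IsMatching A M → a ∉ endpoints M → b ∉ endpoints M → a ~[ A ] b →
    IsMatching A ((a , b) ∷ M)
  ∷-matching (adjacent , distinct) a∉ b∉ a~b =
    a~b ∷ adjacent , (~-≢ a~b ∷ ¬Any⇒All¬ _ a∉) ∷ ¬Any⇒All¬ _ b∉ ∷ distinct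

  ∷-matching⁻ : IsMatching A ((a , b) ∷ M) →
    IsMatching A M × a ≢ b × a ∉ endpoints M × b ∉ endpoints M
  ∷-matching⁻ (_ ∷ adjacent , (a∉ ∷ b∉ ∷ distinct)) =
    (adjacent , distinct) , All.head a∉ , All¬⇒¬Any (All.tail a∉) , All¬⇒¬Any b∉

  partner-unique : IsMatching A M → Partner M a b → Partner M a c → b ≡ c
  partner-unique {M = []} _ (inj₁ ()) _
  partner-unique {M = []} _ (inj₂ ()) _
  partner-unique {M = (x , y) ∷ M} mat ab ac with ∷-matching⁻ mat | partner∷ ab | partner∷ ac
  ... | _ | forward  | forward  = refl
  ... | _ | backward | backward = refl
  ... | (_ , x≢y , _) | forward  | backward = ⊥-elim (x≢y refl)
  ... | (_ , x≢y , _) | backward | forward  = ⊥-elim (x≢y refl)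
  ... | (_ , _ , x∉ , _) | forward  | later ac′ = ⊥-elim (x∉ (partner-endpoint ac′))
  ... | (_ , _ , x∉ , _) | later ab′ | forward  = ⊥-elim (x∉ (partner-endpoint ab′))
  ... | (_ , _ , _ , y∉) | backward | later ac′ = ⊥-elim (y∉ (partner-endpoint ac′))
  ... | (_ , _ , _ , y∉) | later ab′ | backward = ⊥-elim (y∉ (partner-endpoint ab′))
  ... | (mat′ , _) | later ab′ | later ac′ = partner-unique mat′ ab′ ac′

  endpoints-↭ : M ↭ M′ → endpoints M ↭ endpoints M′
  endpoints-↭ Perm.refl                       = Perm.refl
  endpoints-↭ (Perm.prep (a , b) M↭)          = Perm.prep a (Perm.prep b (endpoints-↭ M↭))
  endpoints-↭ (Perm.swap (a , b) (c , d) M↭) =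
    Perm.trans (shifts (a ∷ b ∷ []) (c ∷ d ∷ [])) (++⁺ˡ (c ∷ d ∷ a ∷ b ∷ []) (endpoints-↭ M↭))
  endpoints-↭ (Perm.trans M↭ M↭′)             = Perm.trans (endpoints-↭ M↭) (endpoints-↭ M↭′)

  matching-↭ : M ↭ M′ → IsMatching A M → IsMatching A M′
  matching-↭ M↭ (adjacent , distinct) = All-resp-↭ M↭ adjacent , unique-↭ (endpoints-↭ M↭) distinct

  partner-↭ : M ↭ M′ → Partner M x y → Partner M′ x y
  partner-↭ M↭ (inj₁ xy∈) = inj₁ (∈-resp-↭ M↭ xy∈)
  partner-↭ M↭ (inj₂ yx∈) = inj₂ (∈-resp-↭ M↭ yx∈)

  toFront : t ∈ M → Σ (List E) λ R → M ↭ t ∷ R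
  toFront t∈M with ys , zs , refl ← ∈-∃++ t∈M = ys ++ zs , shift _ ys zs

  record Deletion (M : List E) (h p : V) : Set where
    field
      rest       : List E
      isMatching : IsMatching A rest
      size       : length M ≡ suc (length rest)
      hFree      : h ∉ endpoints rest
      pFree      : p ∉ endpoints rest
      endpoints⊆ : endpoints rest ⊆ endpoints M
      keeps      : ∀ {x y} → x ≢ h → x ≢ p → Partner M x y → Partner rest x y

  deleteEdge : IsMatching A M → (h , p) ∈ M → Deletion M h p
  deleteEdge mat hp∈M with toFront hp∈M
  ... | R , M↭ with ∷-matching⁻ (matching-↭ M↭ mat)
  ... | R-matching , _ , h∉ , p∉ = record
    { rest       = R
    ; isMatching = R-matching
    ; size       = ↭-length M↭
    ; hFree      = h∉
    ; pFree      = p∉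
    ; endpoints⊆ = λ w∈R → ∈-resp-↭ (↭-sym (endpoints-↭ M↭)) (there (there w∈R))
    ; keeps      = λ x≢h x≢p xy → partner∷⁻ (partner-↭ M↭ xy) x≢h x≢p
    }

  deletePartners : IsMatching A M → Partner M h p → Deletion M h p
  deletePartners mat (inj₁ hp∈M) = deleteEdge mat hp∈M
  deletePartners mat (inj₂ ph∈M) = record
    { rest = rest ; isMatching = isMatching ; size = size ; hFree = pFree ; pFree = hFree
    ; endpoints⊆ = endpoints⊆ ; keeps = λ x≢h x≢p → keeps x≢p x≢h }
    where open Deletion (deleteEdge mat ph∈M)

  record Release (M : List E) (h : V) (T : List V) : Set where
    field
      matching      : List E
      isMatching    : IsMatching A matching
      sameSize      : length matching ≡ length M
      freesH        : h ∉ endpoints matching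
      keepsPartners : ∀ {x y} → x ∈ T → Partner M x y → Partner matching x y
      keepsFree     : ∀ {w} → w ∈ T → w ∉ endpoints M → w ∉ endpoints matching

  release-free : IsMatching A M → h ∉ endpoints M → Release M h T
  release-free {M = M} mat h∉ = record
    { matching = M ; isMatching = mat ; sameSize = refl ; freesH = h∉
    ; keepsPartners = λ _ xy → xy ; keepsFree = λ _ w∉ → w∉ }

  release-chain : (r : Release M j T′) → T ⊆ T′ → Release (Release.matching r) h T →
    Release M h T
  release-chain r T⊆T′ r′ = record
    { matching      = R′.matching
    ; isMatching    = R′.isMatching
    ; sameSize      = trans R′.sameSize R.sameSize
    ; freesH        = R′.freesH
    ; keepsPartners = λ x∈T xy → R′.keepsPartners x∈T (R.keepsPartners (T⊆T′ x∈T) xy)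
    ; keepsFree     = λ w∈T w∉ → R′.keepsFree w∈T (R.keepsFree (T⊆T′ w∈T) w∉)
    }
    where
    module R = Release r
    module R′ = Release r′

  release-shift : IsMatching A M → Partner M h p → j ∉ endpoints M → p ~[ A ] j →
    h ∉ T → p ∉ T → j ∉ T → Release M h T
  release-shift {h = h} {p} {j} mat h-p j∉M p~j h∉T p∉T j∉T = record
    { matching      = (p , j) ∷ rest
    ; isMatching    = ∷-matching isMatching pFree j∉rest p~j
    ; sameSize      = sym size
    ; freesH        = ∉-∷ (~-≢ (partner-~ mat h-p)) (∉-∷ h≢j hFree)
    ; keepsPartners = λ x∈T xy → partner-there (keeps (∈-∉⇒≢ x∈T h∉T) (∈-∉⇒≢ x∈T p∉T) xy)
    ; keepsFree     = λ w∈T w∉M →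
        ∉-∷ (∈-∉⇒≢ w∈T p∉T) (∉-∷ (∈-∉⇒≢ w∈T j∉T) (λ w∈ → w∉M (endpoints⊆ w∈)))
    }
    where
    open Deletion (deletePartners mat h-p)
    j∉rest : j ∉ endpoints rest
    j∉rest j∈ = j∉M (endpoints⊆ j∈)
    h≢j : h ≢ j
    h≢j = ∈-∉⇒≢ (partner-endpoint h-p) j∉M

  augment₃ : ∀ {u v c d} → IsMatching A M → Partner M u v →
    c ∉ endpoints M → d ∉ endpoints M → c ≢ d → c ~[ A ] u → v ~[ A ] d →
    Σ (List E) λ M′ → IsMatching A M′ × length M′ ≡ suc (length M)
  augment₃ {u = u} {v} {c} {d} mat u-v c∉M d∉M c≢d c~u v~d =
    (v , d) ∷ matching , ∷-matching isMatching freesH (keepsFree (here refl) d∉M) v~d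
                       , cong suc sameSize
    where
    u≢d : u ≢ d
    u≢d = ∈-∉⇒≢ (partner-endpoint u-v) d∉M
    open Release (release-shift {T = d ∷ []} mat (partner-sym u-v) c∉M (~-sym c~u)
                   (∉-singleton (~-≢ v~d)) (∉-singleton u≢d) (∉-singleton c≢d))

module Tree {n : ℕ} {A : Adj n} (tree : IsTree A) where
  open IsTree tree
  open SimpleGraph symmetric irreflexive

  private variable
    h k p s w : V
    L : List V

  walkTo : Walk A h w L → Unique L → p ∈ L →
    Σ (List V) λ ws → Walk A h p ws × Unique ws × ws ⊆ L
  walkTo (here _)   _ (here refl) = _ ∷ [] , here _ , [] ∷ [] , head⊆
  walkTo (here _)   _ (there ())
  walkTo (step _ _) _ (here refl) = _ ∷ [] , here _ , [] ∷ [] , head⊆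
  walkTo (step h~k W) (h∉ ∷ distinct) (there p∈) =
    let (ws , W′ , distinct′ , ws⊆) = walkTo W distinct p∈
    in _ ∷ ws , step h~k W′ , anti-mono ws⊆ h∉ ∷ distinct′ , ∷⁺ʳ _ ws⊆

  walk-length : ∀ {ws} → Walk A k p ws → k ≢ p → 2 ≤ length ws
  walk-length (here _)            k≢p = ⊥-elim (k≢p refl)
  walk-length (step _ (here _))   _   = s≤s (s≤s z≤n)
  walk-length (step _ (step _ _)) _   = s≤s (s≤s z≤n)

  -- Acyclicity: a neighbour p of the first vertex h of a path h, s, … that is not its
  -- second vertex s lies off the path, since otherwise the segment of the path from h
  -- to p closes a cycle with the edge p–h.
  off-path : Walk A h w (h ∷ s ∷ L) → Unique (h ∷ s ∷ L) → p ~[ A ] h → p ≢ s →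
    p ∉ h ∷ s ∷ L
  off-path _ _ p~h _   (here refl)         = ~-≢ p~h refl
  off-path _ _ _   p≢s (there (here refl)) = p≢s refl
  off-path (step _ (here _)) _ _ _ (there (there ()))
  off-path (step h~s W@(step _ _)) (h∉ ∷ distinct) p~h p≢s (there (there p∈L)) =
    let (ws , W′ , distinct′ , ws⊆) = walkTo W distinct (there p∈L)
        s≢p = ≢-sym (∈-∉⇒≢ p∈L (Unique[x∷xs]⇒x∉xs distinct))
    in acyclic (_ , _ , _ ∷ ws , step h~s W′ , anti-mono ws⊆ h∉ ∷ distinct′
               , s≤s (walk-length W′ s≢p) , p~h)

  -- If h is matched, to p say,
  -- then p lies off the path, and support propagation gives a neighbour j ≠ h of p with
  -- x j ≠ 0; so j, p, h, s, L is again a path.  Free j recursively (keeping h–p) and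
  -- shift the edge h–p to p–j.  Paths have at most n vertices, so the fuel f suffices.
  releaseSupport : ∀ {x M} → InNullSpace A x → IsMatching A M →
    Walk A h w (h ∷ s ∷ L) → Unique (h ∷ s ∷ L) → x h ≢ 0ℚ → ¬ Partner M h s →
    Release M h (s ∷ L)
  releaseSupport {x = x} {M} null mat = go n (m≤m+n n _)
    where
    fuel-step : ∀ {m} f k → m ≤ suc f + k → m ≤ f + suc (suc k)
    fuel-step f k bound =
      ≤-trans bound (≤-trans (n≤1+n _)
        (≤-reflexive (sym (trans (+-suc f (suc k)) (cong suc (+-suc f k))))))

    go : ∀ {h s w L} f → n ≤ f + length L →
      Walk A h w (h ∷ s ∷ L) → Unique (h ∷ s ∷ L) → x h ≢ 0ℚ → ¬ Partner M h s →
      Release M h (s ∷ L)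
    go zero bound _ distinct _ _ =
      ⊥-elim (1+n≰n (≤-trans (n≤1+n _) (≤-trans (unique-length≤ distinct) bound)))
    go {h} {s} {w} {L} (suc f) bound W distinct xh≢0 h≁s with partner? M h
    ... | inj₁ h∉M = release-free mat h∉M
    ... | inj₂ (p , h-p) = shiftFrom (otherSupportNeighbour A null p~h xh≢0)
      where
      p~h : p ~[ A ] h
      p~h = partner-~ mat (partner-sym h-p)

      p∉ : p ∉ h ∷ s ∷ L
      p∉ = off-path W distinct p~h (λ { refl → h≁s h-p })

      shiftFrom : (Σ V λ j → j ≢ h × p ~[ A ] j × x j ≢ 0ℚ) → Release M h (s ∷ L)
      shiftFrom (j , j≢h , p~j , xj≢0) =
        release-chain r (λ t∈ → there (there t∈))
          (release-shift (Release.isMatching r) (Release.keepsPartners r (there (here refl)) h-p)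
                         (Release.freesH r) p~j
                         (Unique[x∷xs]⇒x∉xs distinct) (λ p∈ → p∉ (there p∈))
                         (λ j∈ → j∉ (there (there j∈))))
        where
        j∉ : j ∉ p ∷ h ∷ s ∷ L
        j∉ = off-path (step p~h W) (¬Any⇒All¬ _ p∉ ∷ distinct) (~-sym p~j) j≢h

        j≁p : ¬ Partner M j p
        j≁p j-p = j≢h (partner-unique mat (partner-sym j-p) (partner-sym h-p))

        r : Release M j (p ∷ h ∷ s ∷ L)
        r = go f (fuel-step f (length L) bound) (step (~-sym p~j) (step p~h W))
               (¬Any⇒All¬ _ j∉ ∷ ¬Any⇒All¬ _ p∉ ∷ distinct) xj≢0 j≁p

  -- Otherwise pick support
  -- neighbours c of u and d of v off the edge; free d along the path d, v, u, then free c
  -- along c, u, v, d (keeping u–v and d free); now c–u–v–d is an augmenting path.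
  notBothCore : ∀ {M u v} → IsMaximumMatching A M → (u , v) ∈ M → Core A u → Core A v → ⊥
  notBothCore {M} {u} {v} (mat , maximum) uv∈M coreU coreV =
    contradiction (supportNeighbourAvoiding coreU u~v) (supportNeighbourAvoiding coreV v~u)
    where
    u-v : Partner M u v
    u-v = inj₁ uv∈M
    u~v : u ~[ A ] v
    u~v = partner-~ mat u-v
    v~u : v ~[ A ] u
    v~u = ~-sym u~v

    contradiction : (Σ V λ c → Supp A c × c ~[ A ] u × c ≢ v) →
                    (Σ V λ d → Supp A d × d ~[ A ] v × d ≢ u) → ⊥
    contradiction (c , (x , nullX , xc≢0) , c~u , c≢v) (d , (y , nullY , yd≢0) , d~v , d≢u) =
      tooLarge (augment₃ R₂.isMatching (R₂.keepsPartners (here refl) u-v₁) R₂.freesH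
                 (R₂.keepsFree (there (there (here refl))) R₁.freesH)
                 (λ c≡d → c∉ (there (there (here c≡d)))) c~u (~-sym d~v))
      where
      path-uvd : Walk A u d (u ∷ v ∷ d ∷ [])
      path-uvd = step u~v (step (~-sym d~v) (here d))
      distinct-uvd : Unique (u ∷ v ∷ d ∷ [])
      distinct-uvd = (~-≢ u~v ∷ ≢-sym d≢u ∷ []) ∷ (≢-sym (~-≢ d~v) ∷ []) ∷ [] ∷ []
      c∉ : c ∉ u ∷ v ∷ d ∷ []
      c∉ = off-path path-uvd distinct-uvd c~u c≢v

      r₁ : Release M d (v ∷ u ∷ [])
      r₁ = releaseSupport nullY mat (step d~v (step v~u (here u)))
             ((~-≢ d~v ∷ d≢u ∷ []) ∷ (~-≢ v~u ∷ []) ∷ [] ∷ []) yd≢0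
             (λ d-v → d≢u (partner-unique mat (partner-sym d-v) (partner-sym u-v)))
      module R₁ = Release r₁
      u-v₁ : Partner R₁.matching u v
      u-v₁ = R₁.keepsPartners (there (here refl)) u-v

      r₂ : Release R₁.matching c (u ∷ v ∷ d ∷ [])
      r₂ = releaseSupport nullX R₁.isMatching (step c~u path-uvd) (¬Any⇒All¬ _ c∉ ∷ distinct-uvd)
             xc≢0 (λ c-u → c≢v (partner-unique R₁.isMatching (partner-sym c-u) u-v₁))
      module R₂ = Release r₂

      tooLarge : (Σ (List E) λ M′ → IsMatching A M′ × length M′ ≡ suc (length R₂.matching)) → ⊥
      tooLarge (M′ , M′-matching , M′-size) =
        1+n≰n (subst (_≤ length M) (trans M′-size (cong suc (trans R₂.sameSize R₁.sameSize)))
                     (maximum M′ M′-matching))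

coreEnd : ∀ {n} {A : Adj n} → IsSTree A → ∀ {u v} → u ~[ A ] v → Core A u ⊎ Core A v
coreEnd (_ , dominated) {u} u~v with dominated u
... | _ , supp , inj₁ refl = inj₂ (u , supp , u~v)
... | w , supp , inj₂ w~u  = inj₁ (w , supp , w~u)

exactlyOne : ∀ {P Q : Set} → P ⊎ Q → ¬ (P × Q) → (P × ¬ Q) ⊎ (¬ P × Q)
exactlyOne (inj₁ p) ¬both = inj₁ (p , λ q → ¬both (p , q))
exactlyOne (inj₂ q) ¬both = inj₂ ((λ p → ¬both (p , q)) , q)

mainTheorem7 : (n : ℕ) (A : Adj n) → IsSTree A →
    (M : List (Fin n × Fin n)) → IsMaximumMatching A M →
    (e : Fin n × Fin n) → e ∈ M → ExactlyOneIn (Core A) e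
mainTheorem7 n A sTree M maximum (u , v) uv∈M =
  exactlyOne (coreEnd sTree u~v) (λ (coreU , coreV) → notBothCore maximum uv∈M coreU coreV)
  where
  open Tree (proj₁ sTree) using (notBothCore)
  u~v : u ~[ A ] v
  u~v = All.lookup (proj₁ (proj₁ maximum)) uv∈M
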